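{- Let $s\leq t$ be positive integers and let $b=\binom t2$. Then \[r_{K_s}(K_t)\geq m(b)^{s/t}\geq 2^{s(t-1)/2-1}.\]
   Context: All graphs are finite and simple. A graph $G$ is $K_t$-Ramsey if every two-coloring of the edges of $G$ contains a monochromatic copy of $K_t$. $r_{K_s}(K_t)$ is the minimum number of copies of $K_s$ in a graph which is $K_t$-Ramsey. For a positive integer $b$, $m(b)$ denotes the minimum number of edges in a $b$-uniform hypergraph without property B, i.e. a $b$-uniform hypergraph admitting no two-coloring of its vertices in which no edge is monochromatic. -}

module Defs where

open import Data.Nat using (ℕ; zero; suc; _≤_)
open import Data.Bool using (Bool; true; false)
open import Data.Fin using (Fin; _≟_)
open import Data.Fin.Properties using (all?)
open import Data.Fin.Subset using (Subset; _∈_; ∣_∣)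
open import Data.Fin.Subset.Properties using (_∈?_)
open import Data.Vec using (Vec; []; _∷_)
open import Data.List using (List; []; _∷_; _++_; map; filter; length)
open import Data.List.Membership.Propositional using () renaming (_∈_ to _∈ₗ_)
open import Data.List.Relation.Unary.Unique.Propositional using (Unique)
open import Data.Product using (Σ; ∃; _×_; _,_)
open import Relation.Binary.PropositionalEquality using (_≡_; _≢_)
open import Relation.Nullary using (Dec; ¬_)
open import Relation.Nullary.Decidable using (_×-dec_; _→-dec_; ¬?)
open import Data.Nat.Properties using () renaming (_≟_ to _≟ℕ_)

record Graph (n : ℕ) : Set where
  field
    adj    : Fin n → Fin n → Bool
    sym    : ∀ i j → adj i j ≡ adj j i
    irrefl : ∀ i → adj i i ≡ false
open Graph public

IsClique : ∀ {n} → Graph n → Subset n → Set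
IsClique G S = ∀ i j → i ∈ S → j ∈ S → i ≢ j → adj G i j ≡ true

isClique? : ∀ {n} (G : Graph n) (S : Subset n) → Dec (IsClique G S)
isClique? G S =
  all? λ i → all? λ j →
    (i ∈? S) →-dec ((j ∈? S) →-dec (¬? (i ≟ j) →-dec (adj G i j Data.Bool.≟ true)))

allSubsets : ∀ n → List (Subset n)
allSubsets zero = [] ∷ []
allSubsets (suc n) = map (true ∷_) (allSubsets n) ++ map (false ∷_) (allSubsets n)

numKs : ∀ {n} → ℕ → Graph n → ℕ
numKs s G = length (filter (λ S → (∣ S ∣ ≟ℕ s) ×-dec isClique? G S) (allSubsets _))

IsEdgeColouring : ∀ {n} → (Fin n → Fin n → Bool) → Set
IsEdgeColouring {n} c = ∀ i j → c i j ≡ c j i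

MonoClique : ∀ {n} → Graph n → (Fin n → Fin n → Bool) → Bool → ℕ → Subset n → Set
MonoClique G c col t S =
  ∣ S ∣ ≡ t × (∀ i j → i ∈ S → j ∈ S → i ≢ j → adj G i j ≡ true × c i j ≡ col)

IsRamsey : ∀ {n} → ℕ → Graph n → Set
IsRamsey {n} t G =
  (c : Fin n → Fin n → Bool) → IsEdgeColouring c →
  ∃ λ col → ∃ λ S → MonoClique G c col t S

IsRKsKt : ℕ → ℕ → ℕ → Set
IsRKsKt s t R =
  (∃ λ n → Σ (Graph n) λ G → IsRamsey t G × numKs s G ≡ R) ×
  (∀ n (G : Graph n) → IsRamsey t G → R ≤ numKs s G)

record Hypergraph (n : ℕ) : Set where
  field
    edges  : List (Subset n)
    unique : Unique edges
open Hypergraph public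

IsUniform : ∀ {n} → ℕ → Hypergraph n → Set
IsUniform b H = ∀ e → e ∈ₗ edges H → ∣ e ∣ ≡ b

Monochromatic : ∀ {n} → (Fin n → Bool) → Subset n → Set
Monochromatic f e = ∃ λ col → ∀ i → i ∈ e → f i ≡ col

HasPropertyB : ∀ {n} → Hypergraph n → Set
HasPropertyB {n} H =
  Σ (Fin n → Bool) λ f → ∀ e → e ∈ₗ edges H → ¬ Monochromatic f e

IsMB : ℕ → ℕ → Set
IsMB b M =
  (∃ λ n → Σ (Hypergraph n) λ H →
     IsUniform b H × ¬ HasPropertyB H × length (edges H) ≡ M) ×
  (∀ n (H : Hypergraph n) → IsUniform b H → ¬ HasPropertyB H → M ≤ length (edges H))

module Submission where

open import Defs
open import Data.Nat using (ℕ; _≤_; _*_; _^_)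
open import Data.Nat.Combinatorics using (_C_)
open import Data.Product using (_×_)

-- Let G be a K_t-Ramsey graph with R copies of K_s and let K_j be its number of j-cliques.
-- Colouring the edges of G is colouring the vertices of the hypergraph whose edges are the
-- edge sets of the copies of K_t, so this (t choose 2)-uniform hypergraph lacks property B
-- and m(b) ≤ K_t. The clique counts satisfy K_(j+1)^j ≤ K_j^(j+1) (induction on the number
-- of vertices, splitting off the cliques through one vertex), and chaining these gives
-- K_t^s ≤ K_s^t. The second inequality is Erdős' bound 2^b ≤ 2 m(b) raised to the s-th power.

open import Data.Bool using (Bool; true; false; _∧_; if_then_else_)
open import Data.Bool.Properties using (∧-conicalˡ; ∧-conicalʳ) renaming (_≟_ to _≟ᵇ_)
open import Data.Fin using (Fin; zero; suc; _↑ˡ_; _↑ʳ_) renaming (_≟_ to _≟ᶠ_)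
open import Data.Fin.Properties using (all?) renaming (suc-injective to fsuc-injective)
open import Data.Fin.Subset using (Subset; _∈_; ∣_∣; ⊥)
open import Data.Fin.Subset.Properties using (_∈?_; ∉⊥; ∣⊥∣≡0)
open import Data.List using (List; []; _∷_; _++_; map; filter; length; deduplicate; cartesianProduct)
open import Data.List.Properties
  using (filter-++; filter-none; filter-≐; length-++; length-map; length-deduplicate)
open import Data.List.Membership.Propositional using (lose) renaming (_∈_ to _∈ₗ_)
open import Data.List.Membership.Propositional.Properties
  using (∈-map⁺; ∈-map⁻; ∈-++⁺ˡ; ∈-++⁺ʳ; ∈-filter⁺; ∈-filter⁻; ∈-deduplicate⁺; ∈-deduplicate⁻;
         ∈-cartesianProduct⁺; ∈-cartesianProduct⁻)
open import Data.List.Relation.Unary.All using (universal)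
open import Data.List.Relation.Unary.Any using (Any; here; there)
import Data.List.Relation.Unary.Any as Any
open import Data.List.Relation.Unary.Unique.DecPropositional.Properties using (deduplicate-!)
open import Data.Nat
open import Data.Nat.Combinatorics using (nC1≡n; nCk+nC[k+1]≡[n+1]C[k+1])
open import Data.Nat.ListAction using (sum)
open import Data.Nat.Properties
open import Algebra.Properties.CommutativeSemigroup *-commutativeSemigroup using (xy∙z≈xz∙y; x∙yz≈y∙xz)
open import Data.Product using (_,_; proj₁; proj₂)
open import Data.Sum using (inj₁; inj₂)
open import Data.Vec using ([]; _∷_; here; there)
import Data.Vec as Vec
import Data.Vec.Properties as Vec
open import Function using (_∘_)
open import Level using (Level)
open import Relation.Binary.PropositionalEquality hiding (sym)
import Relation.Binary.PropositionalEquality as ≡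
open import Relation.Nullary using (¬_; does; yes; no)
open import Relation.Nullary.Decidable using (_×-dec_; _→-dec_; ¬?)
open import Relation.Nullary.Negation using (contradiction)
open import Relation.Unary using (Pred; Decidable; _≐_)

^-distribʳ-* : ∀ m n o → (m * n) ^ o ≡ m ^ o * n ^ o
^-distribʳ-* m n zero    = refl
^-distribʳ-* m n (suc o) = begin
  m * n * (m * n) ^ o     ≡⟨ cong (m * n *_) (^-distribʳ-* m n o) ⟩
  m * n * (m ^ o * n ^ o) ≡⟨ [m*n]*[o*p]≡[m*o]*[n*p] m n (m ^ o) (n ^ o) ⟩
  m ^ suc o * n ^ suc o   ∎
  where open ≡-Reasoning

^-comm-exponents : ∀ x m n → (x ^ m) ^ n ≡ (x ^ n) ^ m
^-comm-exponents x m n = begin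
  (x ^ m) ^ n ≡⟨ ^-*-assoc x m n ⟩
  x ^ (m * n) ≡⟨ cong (x ^_) (*-comm m n) ⟩
  x ^ (n * m) ≡⟨ ^-*-assoc x n m ⟨
  (x ^ n) ^ m ∎
  where open ≡-Reasoning

^-cancelʳ-≤ : ∀ m n o .{{_ : NonZero o}} → m ^ o ≤ n ^ o → m ≤ n
^-cancelʳ-≤ m n o mᵒ≤nᵒ with m ≤? n
... | yes m≤n = m≤n
... | no  m≰n = contradiction mᵒ≤nᵒ (<⇒≱ (^-monoˡ-< o (≰⇒> m≰n)))

^-mediant-≤-larger : ∀ m W a b x y → a * y ≤ b * x →
                     a ^ m ≤ W * x ^ m → b ^ m ≤ W * y ^ m → (a + b) ^ m ≤ W * (x + y) ^ m
^-mediant-≤-larger zero    W a b x zero ay≤bx aᵐ≤ bᵐ≤ = aᵐ≤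
^-mediant-≤-larger (suc k) W a b x zero ay≤bx aᵐ≤ bᵐ≤
  rewrite m^n≡0⇒m≡0 b (suc k) (n≤0⇒n≡0 (≤-trans bᵐ≤ (≤-reflexive (*-zeroʳ W))))
        | +-identityʳ a | +-identityʳ x = aᵐ≤
^-mediant-≤-larger m W a b x y@(suc _) ay≤bx aᵐ≤ bᵐ≤ =
  *-cancelʳ-≤ _ _ (y ^ m) {{m^n≢0 y m}} (begin
    (a + b) ^ m * y ^ m     ≡⟨ ^-distribʳ-* (a + b) y m ⟨
    ((a + b) * y) ^ m       ≤⟨ ^-monoˡ-≤ m [a+b]y≤b[x+y] ⟩
    (b * (x + y)) ^ m       ≡⟨ ^-distribʳ-* b (x + y) m ⟩
    b ^ m * (x + y) ^ m     ≤⟨ *-monoˡ-≤ ((x + y) ^ m) bᵐ≤ ⟩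
    W * y ^ m * (x + y) ^ m ≡⟨ xy∙z≈xz∙y W (y ^ m) ((x + y) ^ m) ⟩
    W * (x + y) ^ m * y ^ m ∎)
  where
  open ≤-Reasoning
  [a+b]y≤b[x+y] : (a + b) * y ≤ b * (x + y)
  [a+b]y≤b[x+y] = begin
    (a + b) * y   ≡⟨ *-distribʳ-+ y a b ⟩
    a * y + b * y ≤⟨ +-monoˡ-≤ (b * y) ay≤bx ⟩
    b * x + b * y ≡⟨ *-distribˡ-+ b x y ⟨
    b * (x + y)   ∎

^-mediant-≤ : ∀ m W a b x y → a ^ m ≤ W * x ^ m → b ^ m ≤ W * y ^ m →
              (a + b) ^ m ≤ W * (x + y) ^ m
^-mediant-≤ m W a b x y aᵐ≤ bᵐ≤ with ≤-total (a * y) (b * x)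
... | inj₁ ay≤bx = ^-mediant-≤-larger m W a b x y ay≤bx aᵐ≤ bᵐ≤
... | inj₂ bx≤ay = subst₂ (λ u v → u ^ m ≤ W * v ^ m) (+-comm b a) (+-comm y x)
                          (^-mediant-≤-larger m W b a y x bx≤ay bᵐ≤ aᵐ≤)

root-antitone : (K : ℕ → ℕ) → (∀ j → K (suc j) ^ j ≤ K j ^ suc j) →
                ∀ {s t} → 1 ≤ s → s ≤ t → K t ^ s ≤ K s ^ t
root-antitone K step 1≤s s≤t = go 1≤s (≤⇒≤′ s≤t)
  where
  go : ∀ {s t} → 1 ≤ s → s ≤′ t → K t ^ s ≤ K s ^ t
  go _ ≤′-refl = ≤-refl
  go {s} {suc t} 1≤s (≤′-step s≤′t) =
    ^-cancelʳ-≤ _ _ t {{>-nonZero (≤-trans 1≤s (≤′⇒≤ s≤′t))}} (begin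
      (K (suc t) ^ s) ^ t   ≡⟨ ^-comm-exponents (K (suc t)) s t ⟩
      (K (suc t) ^ t) ^ s   ≤⟨ ^-monoˡ-≤ s (step t) ⟩
      (K t ^ suc t) ^ s     ≡⟨ ^-comm-exponents (K t) (suc t) s ⟩
      (K t ^ s) ^ suc t     ≤⟨ ^-monoˡ-≤ (suc t) (go 1≤s s≤′t) ⟩
      (K s ^ t) ^ suc t     ≡⟨ ^-comm-exponents (K s) t (suc t) ⟩
      (K s ^ suc t) ^ t     ∎)
    where open ≤-Reasoning

private
  variable
    ℓ ℓ′ : Level
    A B : Set ℓ

count : {P : Pred A ℓ} → Decidable P → List A → ℕ
count P? xs = length (filter P? xs)

module _ {P : Pred A ℓ} (P? : Decidable P) where

  count-++ : ∀ xs ys → count P? (xs ++ ys) ≡ count P? xs + count P? ys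
  count-++ xs ys = trans (cong length (filter-++ P? xs ys)) (length-++ (filter P? xs))

  count-map : (f : B → A) → ∀ xs → count P? (map f xs) ≡ count (P? ∘ f) xs
  count-map f []       = refl
  count-map f (x ∷ xs) with does (P? (f x))
  ... | true  = cong suc (count-map f xs)
  ... | false = count-map f xs

  count-none : (∀ x → ¬ P x) → ∀ xs → count P? xs ≡ 0
  count-none ¬P xs = cong length (filter-none P? (universal ¬P xs))

  count-≤-∷ : ∀ x xs → count P? xs ≤ count P? (x ∷ xs)
  count-≤-∷ x xs with does (P? x)
  ... | true  = n≤1+n _
  ... | false = ≤-refl

  count-<-∷ : ∀ {x} xs → P x → count P? xs < count P? (x ∷ xs)
  count-<-∷ {x} xs px with P? x
  ... | yes _ = ≤-refl
  ... | no ¬px = contradiction px ¬px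

count-≐ : {P : Pred A ℓ} {Q : Pred A ℓ′} (P? : Decidable P) (Q? : Decidable Q) →
          P ≐ Q → ∀ xs → count P? xs ≡ count Q? xs
count-≐ P? Q? P≐Q xs = cong length (filter-≐ P? Q? P≐Q xs)

module _ {f g : A → ℕ} (f≤g : ∀ x → f x ≤ g x) where

  sum-map-mono-≤ : ∀ xs → sum (map f xs) ≤ sum (map g xs)
  sum-map-mono-≤ []       = z≤n
  sum-map-mono-≤ (x ∷ xs) = +-mono-≤ (f≤g x) (sum-map-mono-≤ xs)

  sum-map-mono-< : ∀ {xs} → Any (λ x → f x < g x) xs → sum (map f xs) < sum (map g xs)
  sum-map-mono-< {x ∷ xs} (here fx<gx)  = +-mono-<-≤ fx<gx (sum-map-mono-≤ xs)
  sum-map-mono-< {x ∷ xs} (there strict) = +-mono-≤-< (f≤g x) (sum-map-mono-< strict)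

sum-map-*-const : (g : A → ℕ) (k c : ℕ) → ∀ xs → (∀ {x} → x ∈ₗ xs → g x * k ≡ c) →
                  sum (map g xs) * k ≡ length xs * c
sum-map-*-const g k c []       _     = refl
sum-map-*-const g k c (x ∷ xs) g*k≡c =
  trans (*-distribʳ-+ k (g x) _) (cong₂ _+_ (g*k≡c (here refl)) (sum-map-*-const g k c xs (g*k≡c ∘ there)))

union-bound : {R : B → Pred A ℓ} (R? : ∀ e → Decidable (R e)) → ∀ es xs →
              (∀ {x} → x ∈ₗ xs → Any (λ e → R e x) es) →
              length xs ≤ sum (map (λ e → count (R? e) xs) es)
union-bound R? es []       _       = z≤n
union-bound R? es (x ∷ xs) covered =
  ≤-trans (s≤s (union-bound R? es xs (covered ∘ there)))
          (sum-map-mono-< (λ e → count-≤-∷ (R? e) x xs)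
                          (Any.map (count-<-∷ (R? _) xs) (covered (here refl))))

∣allSubsets∣ : ∀ n → length (allSubsets n) ≡ 2 ^ n
∣allSubsets∣ zero    = refl
∣allSubsets∣ (suc n) = begin
  length (map (true ∷_) L ++ map (false ∷_) L)         ≡⟨ length-++ (map (true ∷_) L) ⟩
  length (map (true ∷_) L) + length (map (false ∷_) L) ≡⟨ cong₂ _+_ (length-map _ L) (length-map _ L) ⟩
  length L + length L                                  ≡⟨ cong₂ _+_ (∣allSubsets∣ n) (∣allSubsets∣ n) ⟩
  2 ^ n + 2 ^ n                                        ≡⟨ cong (2 ^ n +_) (+-identityʳ (2 ^ n)) ⟨
  2 ^ suc n                                            ∎
  where
  open ≡-Reasoning
  L = allSubsets n

∈-allSubsets : ∀ {n} (V : Subset n) → V ∈ₗ allSubsets n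
∈-allSubsets []          = here refl
∈-allSubsets (true ∷ V)  = ∈-++⁺ˡ (∈-map⁺ (true ∷_) (∈-allSubsets V))
∈-allSubsets (false ∷ V) = ∈-++⁺ʳ (map (true ∷_) (allSubsets _)) (∈-map⁺ (false ∷_) (∈-allSubsets V))

count-allSubsets-suc : ∀ {n} {P : Pred (Subset (suc n)) ℓ} (P? : Decidable P) →
                       count P? (allSubsets (suc n)) ≡
                       count (P? ∘ (true ∷_)) (allSubsets n) + count (P? ∘ (false ∷_)) (allSubsets n)
count-allSubsets-suc {n = n} P? =
  trans (count-++ P? (map (true ∷_) L) (map (false ∷_) L))
        (cong₂ _+_ (count-map P? (true ∷_) L) (count-map P? (false ∷_) L))
  where L = allSubsets n

-- r need not be symmetric: a clique asks for r i k on every ordered pair of its vertices.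
CliqueIn : ∀ {n} → (Fin n → Fin n → Bool) → (Fin n → Bool) → ℕ → Subset n → Set
CliqueIn r U j S = ∣ S ∣ ≡ j × (∀ i → i ∈ S → U i ≡ true) ×
                   (∀ i k → i ∈ S → k ∈ S → i ≢ k → r i k ≡ true)

cliqueIn? : ∀ {n} r U j → Decidable (CliqueIn {n} r U j)
cliqueIn? r U j S =
  (∣ S ∣ ≟ j) ×-dec (all? λ i → (i ∈? S) →-dec (U i ≟ᵇ true)) ×-dec
  (all? λ i → all? λ k → (i ∈? S) →-dec ((k ∈? S) →-dec (¬? (i ≟ᶠ k) →-dec (r i k ≟ᵇ true))))

dropVertex : ∀ {n} → (Fin (suc n) → Fin (suc n) → Bool) → Fin n → Fin n → Bool
dropVertex r i k = r (suc i) (suc k)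

neighbours₀ : ∀ {n} → (Fin (suc n) → Fin (suc n) → Bool) → (Fin (suc n) → Bool) → Fin n → Bool
neighbours₀ r U i = U (suc i) ∧ (r zero (suc i) ∧ r (suc i) zero)

cliques  : (n : ℕ) → (Fin n → Fin n → Bool) → (Fin n → Bool) → ℕ → ℕ
cliques₀ : (n : ℕ) → (Fin (suc n) → Fin (suc n) → Bool) → (Fin (suc n) → Bool) → ℕ → ℕ
cliques zero    r U zero    = 1
cliques zero    r U (suc j) = 0
cliques (suc n) r U j       = cliques n (dropVertex r) (U ∘ suc) j + cliques₀ n r U j
cliques₀ n r U zero    = 0
cliques₀ n r U (suc j) = if U zero then cliques n (dropVertex r) (neighbours₀ r U) j else 0

module _ {n} (r : Fin (suc n) → Fin (suc n) → Bool) (U : Fin (suc n) → Bool) where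

  cliqueIn-false∷ : ∀ j → CliqueIn r U j ∘ (false ∷_) ≐ CliqueIn (dropVertex r) (U ∘ suc) j
  cliqueIn-false∷ j = to , from
    where
    to : ∀ {S} → CliqueIn r U j (false ∷ S) → CliqueIn (dropVertex r) (U ∘ suc) j S
    to (∣S∣ , inU , clique) =
      ∣S∣ , (λ i i∈S → inU (suc i) (there i∈S)) ,
      λ i k i∈S k∈S i≢k → clique (suc i) (suc k) (there i∈S) (there k∈S) (i≢k ∘ fsuc-injective)
    from : ∀ {S} → CliqueIn (dropVertex r) (U ∘ suc) j S → CliqueIn r U j (false ∷ S)
    from (∣S∣ , inU , clique) =
      ∣S∣ , (λ { (suc i) (there i∈S) → inU i i∈S }) ,
      λ { (suc i) (suc k) (there i∈S) (there k∈S) i≢k → clique i k i∈S k∈S (i≢k ∘ cong suc) }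

  cliqueIn-true∷ : ∀ j → U zero ≡ true →
                   CliqueIn r U (suc j) ∘ (true ∷_) ≐ CliqueIn (dropVertex r) (neighbours₀ r U) j
  cliqueIn-true∷ j U₀ = to , from
    where
    to : ∀ {S} → CliqueIn r U (suc j) (true ∷ S) → CliqueIn (dropVertex r) (neighbours₀ r U) j S
    to (∣S∣ , inU , clique) =
      suc-injective ∣S∣ ,
      (λ i i∈S → cong₂ _∧_ (inU (suc i) (there i∈S))
                           (cong₂ _∧_ (clique zero (suc i) here (there i∈S) λ ())
                                      (clique (suc i) zero (there i∈S) here λ ()))) ,
      λ i k i∈S k∈S i≢k → clique (suc i) (suc k) (there i∈S) (there k∈S) (i≢k ∘ fsuc-injective)
    from : ∀ {S} → CliqueIn (dropVertex r) (neighbours₀ r U) j S → CliqueIn r U (suc j) (true ∷ S)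
    from {S} (∣S∣ , inN , clique) = cong suc ∣S∣ , inU , clique′
      where
      adjacent₀ : ∀ i → i ∈ S → r zero (suc i) ∧ r (suc i) zero ≡ true
      adjacent₀ i i∈S = ∧-conicalʳ (U (suc i)) _ (inN i i∈S)
      inU : ∀ i → i ∈ true ∷ S → U i ≡ true
      inU zero    here          = U₀
      inU (suc i) (there i∈S)   = ∧-conicalˡ (U (suc i)) _ (inN i i∈S)
      clique′ : ∀ i k → i ∈ true ∷ S → k ∈ true ∷ S → i ≢ k → r i k ≡ true
      clique′ zero    zero    _           _           0≢0 = contradiction refl 0≢0
      clique′ zero    (suc k) _           (there k∈S) _   = ∧-conicalˡ _ _ (adjacent₀ k k∈S)
      clique′ (suc i) zero    (there i∈S) _           _   = ∧-conicalʳ _ _ (adjacent₀ i i∈S)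
      clique′ (suc i) (suc k) (there i∈S) (there k∈S) i≢k = clique i k i∈S k∈S (i≢k ∘ cong suc)

count-cliqueIn : ∀ n r U j → count (cliqueIn? r U j) (allSubsets n) ≡ cliques n r U j
count-cliqueIn zero r U zero with cliqueIn? r U zero []
... | yes _ = refl
... | no ¬clique = contradiction (refl , (λ _ ()) , λ _ _ ()) ¬clique
count-cliqueIn zero r U (suc j) with cliqueIn? r U (suc j) []
... | yes (() , _)
... | no _ = refl
count-cliqueIn (suc n) r U j = begin
  count (cliqueIn? r U j) (allSubsets (suc n))     ≡⟨ count-allSubsets-suc (cliqueIn? r U j) ⟩
  count (cliqueIn? r U j ∘ (true ∷_)) L +
  count (cliqueIn? r U j ∘ (false ∷_)) L          ≡⟨ +-comm (count (cliqueIn? r U j ∘ (true ∷_)) L) _ ⟩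
  count (cliqueIn? r U j ∘ (false ∷_)) L +
  count (cliqueIn? r U j ∘ (true ∷_)) L           ≡⟨ cong₂ _+_ avoiding₀ (containing₀ j) ⟩
  cliques (suc n) r U j                           ∎
  where
  open ≡-Reasoning
  L = allSubsets n
  avoiding₀ : count (cliqueIn? r U j ∘ (false ∷_)) L ≡ cliques n (dropVertex r) (U ∘ suc) j
  avoiding₀ = trans (count-≐ _ _ (cliqueIn-false∷ r U j) L) (count-cliqueIn n (dropVertex r) (U ∘ suc) j)
  containing₀ : ∀ j → count (cliqueIn? r U j ∘ (true ∷_)) L ≡ cliques₀ n r U j
  containing₀ zero = count-none _ (λ { S (() , _) }) L
  containing₀ (suc j) = by-root (U zero) refl
    where
    cliques₀≡ : ∀ {b} → U zero ≡ b → cliques₀ n r U (suc j) ≡ (if b then _ else 0)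
    cliques₀≡ = cong (if_then cliques n (dropVertex r) (neighbours₀ r U) j else 0)
    by-root : ∀ b → U zero ≡ b → count (cliqueIn? r U (suc j) ∘ (true ∷_)) L ≡ cliques₀ n r U (suc j)
    by-root true  U₀ = trans (trans (count-≐ _ _ (cliqueIn-true∷ r U j U₀) L)
                                    (count-cliqueIn n (dropVertex r) (neighbours₀ r U) j))
                             (≡.sym (cliques₀≡ U₀))
    by-root false U₀ =
      trans (count-none _ (λ { S (_ , inU , _) → contradiction (trans (≡.sym U₀) (inU zero here)) λ () }) L)
            (≡.sym (cliques₀≡ U₀))

cliques-zero : ∀ n r U → cliques n r U 0 ≡ 1
cliques-zero zero    r U = refl
cliques-zero (suc n) r U = cong (_+ 0) (cliques-zero n (dropVertex r) (U ∘ suc))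

cliques-mono : ∀ n r {U V} → (∀ i → U i ≡ true → V i ≡ true) → ∀ j → cliques n r U j ≤ cliques n r V j
cliques-mono zero    r U⊆V zero    = ≤-refl
cliques-mono zero    r U⊆V (suc j) = ≤-refl
cliques-mono (suc n) r {U} {V} U⊆V j =
  +-mono-≤ (cliques-mono n (dropVertex r) (U⊆V ∘ suc) j) (containing₀ j)
  where
  containing₀ : ∀ j → cliques₀ n r U j ≤ cliques₀ n r V j
  containing₀ zero = z≤n
  containing₀ (suc j) with U zero in U₀
  ... | false = z≤n
  ... | true rewrite U⊆V zero U₀ = cliques-mono n (dropVertex r) neighbours⊆ j
    where
    neighbours⊆ : ∀ i → neighbours₀ r U i ≡ true → neighbours₀ r V i ≡ true
    neighbours⊆ i Nᵢ = cong₂ _∧_ (U⊆V (suc i) (∧-conicalˡ _ _ Nᵢ)) (∧-conicalʳ (U (suc i)) _ Nᵢ)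

-- The (j+1)-cliques through vertex 0 are the j-cliques of its neighbourhood, which the
-- induction hypothesis controls; the mediant inequality combines them with the cliques avoiding 0.
cliques-root-antitone : ∀ n r U j → cliques n r U (suc j) ^ j ≤ cliques n r U j ^ suc j
cliques-root-antitone zero    r U zero    = ≤-refl
cliques-root-antitone zero    r U (suc j) = z≤n
cliques-root-antitone (suc n) r U zero rewrite cliques-zero (suc n) r U = ≤-refl
cliques-root-antitone (suc n) r U (suc j) =
  ≤-trans (^-mediant-≤ (suc j) A₁ A₂ D₂ A₁ D₁ (cliques-root-antitone n r′ U′ (suc j)) containing₀)
          (*-monoˡ-≤ ((A₁ + D₁) ^ suc j) (m≤m+n A₁ D₁))
  where
  r′ = dropVertex r
  U′ = U ∘ suc
  A₁ = cliques n r′ U′ (suc j)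
  A₂ = cliques n r′ U′ (suc (suc j))
  D₁ = cliques₀ n r U (suc j)
  D₂ = cliques₀ n r U (suc (suc j))
  containing₀ : D₂ ^ suc j ≤ A₁ * D₁ ^ suc j
  containing₀ with U zero
  ... | false = z≤n
  ... | true  = *-mono-≤ (cliques-mono n r′ (λ i → ∧-conicalˡ _ _) (suc j))
                         (cliques-root-antitone n r′ (neighbours₀ r U) j)

numKs≡cliques : ∀ {n} j (G : Graph n) → numKs j G ≡ cliques n (adj G) (λ _ → true) j
numKs≡cliques {n} j G =
  trans (count-≐ _ (cliqueIn? (adj G) (λ _ → true) j)
                 ((λ (∣S∣ , clique) → ∣S∣ , (λ _ _ → refl) , clique) ,
                  (λ (∣S∣ , _ , clique) → ∣S∣ , clique))
                 (allSubsets n))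
        (count-cliqueIn n (adj G) (λ _ → true) j)

-- Fin (pairs (suc n)) is Fin n ++ Fin (pairs n): the first block indexes the pairs {0, j+1},
-- the second the pairs inside {1, …, n}.
pairs : ℕ → ℕ
pairs zero    = 0
pairs (suc n) = n + pairs n

pairColouring : ∀ {n} → (Fin (pairs n) → Bool) → Fin n → Fin n → Bool
pairColouring {suc n} f zero    zero    = false
pairColouring {suc n} f zero    (suc j) = f (j ↑ˡ pairs n)
pairColouring {suc n} f (suc i) zero    = f (i ↑ˡ pairs n)
pairColouring {suc n} f (suc i) (suc j) = pairColouring {n} (f ∘ (n ↑ʳ_)) i j

pairColouring-sym : ∀ {n} (f : Fin (pairs n) → Bool) → IsEdgeColouring (pairColouring {n} f)
pairColouring-sym {suc n} f zero    zero    = refl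
pairColouring-sym {suc n} f zero    (suc j) = refl
pairColouring-sym {suc n} f (suc i) zero    = refl
pairColouring-sym {suc n} f (suc i) (suc j) = pairColouring-sym {n} (f ∘ (n ↑ʳ_)) i j

pairsIn : ∀ {n} → Subset n → Subset (pairs n)
pairsIn []      = []
pairsIn (x ∷ S) = (if x then S else ⊥) Vec.++ pairsIn S

∣∣-++ : ∀ {m p} (u : Subset m) (v : Subset p) → ∣ u Vec.++ v ∣ ≡ ∣ u ∣ + ∣ v ∣
∣∣-++ []          v = refl
∣∣-++ (true ∷ u)  v = cong suc (∣∣-++ u v)
∣∣-++ (false ∷ u) v = ∣∣-++ u v

∣pairsIn∣ : ∀ {n} (S : Subset n) → ∣ pairsIn S ∣ ≡ ∣ S ∣ C 2
∣pairsIn∣ []          = refl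
∣pairsIn∣ (true ∷ S)  = begin
  ∣ S Vec.++ pairsIn S ∣      ≡⟨ ∣∣-++ S (pairsIn S) ⟩
  ∣ S ∣ + ∣ pairsIn S ∣       ≡⟨ cong₂ _+_ (≡.sym (nC1≡n ∣ S ∣)) (∣pairsIn∣ S) ⟩
  ∣ S ∣ C 1 + ∣ S ∣ C 2       ≡⟨ nCk+nC[k+1]≡[n+1]C[k+1] ∣ S ∣ 1 ⟩
  suc ∣ S ∣ C 2               ∎
  where open ≡-Reasoning
∣pairsIn∣ {suc n} (false ∷ S) =
  trans (∣∣-++ (⊥ {n}) (pairsIn S)) (trans (cong (_+ ∣ pairsIn S ∣) (∣⊥∣≡0 n)) (∣pairsIn∣ S))

∈-++-elim : ∀ {m p} {P : Pred (Fin (m + p)) ℓ} (u : Subset m) (v : Subset p) →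
            (∀ k → k ∈ u → P (k ↑ˡ p)) → (∀ k → k ∈ v → P (m ↑ʳ k)) → ∀ k → k ∈ u Vec.++ v → P k
∈-++-elim []      v Pu Pv k       k∈v         = Pv k k∈v
∈-++-elim (x ∷ u) v Pu Pv zero    here        = Pu zero here
∈-++-elim (x ∷ u) v Pu Pv (suc k) (there k∈w) =
  ∈-++-elim u v (λ k k∈u → Pu (suc k) (there k∈u)) Pv k k∈w

pairsIn-monochromatic : ∀ {n} (f : Fin (pairs n) → Bool) (c : Bool) (S : Subset n) →
                        (∀ i j → i ∈ S → j ∈ S → i ≢ j → pairColouring {n} f i j ≡ c) →
                        ∀ k → k ∈ pairsIn S → f k ≡ c
pairsIn-monochromatic {suc n} f c (x ∷ S) mono =
  ∈-++-elim (if x then S else ⊥) (pairsIn S) (through₀ x refl)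
    (pairsIn-monochromatic {n} (f ∘ (n ↑ʳ_)) c S
       λ i j i∈S j∈S i≢j → mono (suc i) (suc j) (there i∈S) (there j∈S) (i≢j ∘ fsuc-injective))
  where
  through₀ : ∀ y → x ≡ y → ∀ k → k ∈ (if y then S else ⊥) → f (k ↑ˡ pairs n) ≡ c
  through₀ true  refl k k∈S = mono zero (suc k) here (there k∈S) λ ()
  through₀ false _    k k∈⊥ = contradiction k∈⊥ ∉⊥

module _ {n} (t : ℕ) (G : Graph n) where

  copiesOfK : List (Subset n)
  copiesOfK = filter (λ S → (∣ S ∣ ≟ t) ×-dec isClique? G S) (allSubsets n)

  -- Deduplication is needed because pairsIn identifies all sets of size at most one.
  cliqueHypergraph : Hypergraph (pairs n)
  cliqueHypergraph = record
    { edges  = deduplicate (Vec.≡-dec _≟ᵇ_) (map pairsIn copiesOfK)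
    ; unique = deduplicate-! (Vec.≡-dec _≟ᵇ_) (map pairsIn copiesOfK)
    }

  cliqueHypergraph-uniform : IsUniform (t C 2) cliqueHypergraph
  cliqueHypergraph-uniform e e∈E
    with S , S∈K , refl ← ∈-map⁻ pairsIn (∈-deduplicate⁻ (Vec.≡-dec _≟ᵇ_) (map pairsIn copiesOfK) e∈E)
    with _ , ∣S∣ , _ ← ∈-filter⁻ (λ S → (∣ S ∣ ≟ t) ×-dec isClique? G S) {xs = allSubsets n} S∈K
    = trans (∣pairsIn∣ S) (cong (_C 2) ∣S∣)

  ∣cliqueHypergraph∣ : length (edges cliqueHypergraph) ≤ numKs t G
  ∣cliqueHypergraph∣ = ≤-trans (length-deduplicate (Vec.≡-dec _≟ᵇ_) (map pairsIn copiesOfK))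
                               (≤-reflexive (length-map pairsIn copiesOfK))

  Ramsey⇒¬PropertyB : IsRamsey t G → ¬ HasPropertyB cliqueHypergraph
  Ramsey⇒¬PropertyB ramsey (f , noMono)
    with c , S , ∣S∣ , mono ← ramsey (pairColouring {n} f) (pairColouring-sym {n} f)
    = noMono (pairsIn S) pairsIn-S∈E
        (c , pairsIn-monochromatic {n} f c S (λ i j i∈S j∈S i≢j → proj₂ (mono i j i∈S j∈S i≢j)))
    where
    pairsIn-S∈E : pairsIn S ∈ₗ edges cliqueHypergraph
    pairsIn-S∈E = ∈-deduplicate⁺ (Vec.≡-dec _≟ᵇ_) {xs = map pairsIn copiesOfK}
      (∈-map⁺ pairsIn (∈-filter⁺ (λ S → (∣ S ∣ ≟ t) ×-dec isClique? G S) (∈-allSubsets S)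
        (∣S∣ , λ i j i∈S j∈S i≢j → proj₁ (mono i j i∈S j∈S i≢j))))

m≤numKs : ∀ {n t M} (G : Graph n) → IsMB (t C 2) M → IsRamsey t G → M ≤ numKs t G
m≤numKs {t = t} G (_ , minimal) ramsey =
  ≤-trans (minimal _ (cliqueHypergraph t G) (cliqueHypergraph-uniform t G) (Ramsey⇒¬PropertyB t G ramsey))
          (∣cliqueHypergraph∣ t G)

-- A vertex 2-colouring of Fin n is encoded as a Subset n, so allSubsets n lists all of them.
Monochrome : ∀ {n} → Bool → Subset n → Subset n → Set
Monochrome c e V = ∀ i → i ∈ e → Vec.lookup V i ≡ c

monochrome? : ∀ {n} c (e : Subset n) → Decidable (Monochrome c e)
monochrome? c e V = all? λ i → (i ∈? e) →-dec (Vec.lookup V i ≟ᵇ c)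

module _ {n} (c : Bool) (e : Subset n) where

  count-monochrome-∷ : ∀ x d → (x ≡ true → d ≡ c) →
                       count (monochrome? c (x ∷ e) ∘ (d ∷_)) (allSubsets n) ≡ count (monochrome? c e) (allSubsets n)
  count-monochrome-∷ x d x⇒d≡c = count-≐ _ _ (to , from) (allSubsets n)
    where
    to : ∀ {V} → Monochrome c (x ∷ e) (d ∷ V) → Monochrome c e V
    to mono i i∈e = mono (suc i) (there i∈e)
    from : ∀ {V} → Monochrome c e V → Monochrome c (x ∷ e) (d ∷ V)
    from mono zero    here        = x⇒d≡c refl
    from mono (suc i) (there i∈e) = mono i i∈e

  count-monochrome-clash : ∀ d → d ≢ c → count (monochrome? c (true ∷ e) ∘ (d ∷_)) (allSubsets n) ≡ 0
  count-monochrome-clash d d≢c = count-none _ (λ V mono → d≢c (mono zero here)) (allSubsets n)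

  count-monochrome-true∷ : count (monochrome? c (true ∷ e)) (allSubsets (suc n)) ≡ count (monochrome? c e) (allSubsets n)
  count-monochrome-true∷ = trans (count-allSubsets-suc (monochrome? c (true ∷ e))) (split c refl)
    where
    split : ∀ c′ → c′ ≡ c → count (monochrome? c (true ∷ e) ∘ (true ∷_)) (allSubsets n) +
                            count (monochrome? c (true ∷ e) ∘ (false ∷_)) (allSubsets n) ≡
                            count (monochrome? c e) (allSubsets n)
    split true  refl = trans (cong₂ _+_ (count-monochrome-∷ true true (λ _ → refl))
                                        (count-monochrome-clash false λ ()))
                             (+-identityʳ _)
    split false refl = cong₂ _+_ (count-monochrome-clash true λ ()) (count-monochrome-∷ true false (λ _ → refl))

  count-monochrome-false∷ : count (monochrome? c (false ∷ e)) (allSubsets (suc n)) ≡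
                            count (monochrome? c e) (allSubsets n) + count (monochrome? c e) (allSubsets n)
  count-monochrome-false∷ =
    trans (count-allSubsets-suc (monochrome? c (false ∷ e)))
          (cong₂ _+_ (count-monochrome-∷ false true λ ()) (count-monochrome-∷ false false λ ()))

count-monochrome : ∀ n c (e : Subset n) → count (monochrome? c e) (allSubsets n) * 2 ^ ∣ e ∣ ≡ 2 ^ n
count-monochrome zero c [] with monochrome? c [] []
... | yes _ = refl
... | no ¬mono = contradiction (λ _ ()) ¬mono
count-monochrome (suc n) c (false ∷ e) = begin
  count (monochrome? c (false ∷ e)) (allSubsets (suc n)) * 2 ^ ∣ e ∣ ≡⟨ cong (_* 2 ^ ∣ e ∣) (count-monochrome-false∷ c e) ⟩
  (N + N) * 2 ^ ∣ e ∣                                                ≡⟨ *-distribʳ-+ (2 ^ ∣ e ∣) N N ⟩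
  N * 2 ^ ∣ e ∣ + N * 2 ^ ∣ e ∣                                      ≡⟨ cong₂ _+_ IH (trans IH (≡.sym (+-identityʳ (2 ^ n)))) ⟩
  2 ^ suc n                                                          ∎
  where
  open ≡-Reasoning
  N = count (monochrome? c e) (allSubsets n)
  IH = count-monochrome n c e
count-monochrome (suc n) c (true ∷ e) = begin
  count (monochrome? c (true ∷ e)) (allSubsets (suc n)) * (2 * 2 ^ ∣ e ∣) ≡⟨ cong (_* (2 * 2 ^ ∣ e ∣)) (count-monochrome-true∷ c e) ⟩
  N * (2 * 2 ^ ∣ e ∣)                                                    ≡⟨ x∙yz≈y∙xz N 2 (2 ^ ∣ e ∣) ⟩
  2 * (N * 2 ^ ∣ e ∣)                                                    ≡⟨ cong (2 *_) (count-monochrome n c e) ⟩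
  2 ^ suc n                                                              ∎
  where
  open ≡-Reasoning
  N = count (monochrome? c e) (allSubsets n)

length-cartesianProduct : (xs : List A) (ys : List B) →
                          length (cartesianProduct xs ys) ≡ length xs * length ys
length-cartesianProduct []       ys = refl
length-cartesianProduct (x ∷ xs) ys =
  trans (length-++ (map (x ,_) ys) {cartesianProduct xs ys})
        (cong₂ _+_ (length-map (x ,_) ys) (length-cartesianProduct xs ys))

∈-Bool : ∀ c → c ∈ₗ true ∷ false ∷ []
∈-Bool true  = here refl
∈-Bool false = there (here refl)

-- Every colouring paints some edge in some colour, and a given edge of size b is painted
-- in a given colour by exactly 2^n / 2^b of the 2^n colourings.
¬PropertyB⇒2^b≤2m : ∀ {n b} (H : Hypergraph n) → IsUniform b H → ¬ HasPropertyB H →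
                    2 ^ b ≤ 2 * length (edges H)
¬PropertyB⇒2^b≤2m {n} {b} H uniform ¬B =
  *-cancelʳ-≤ (2 ^ b) (2 * length E) (2 ^ n) {{m^n≢0 2 n}} (begin
    2 ^ b * 2 ^ n                               ≡⟨ *-comm (2 ^ b) (2 ^ n) ⟩
    2 ^ n * 2 ^ b                               ≡⟨ cong (_* 2 ^ b) (∣allSubsets∣ n) ⟨
    length L * 2 ^ b                            ≤⟨ *-monoˡ-≤ (2 ^ b) (union-bound monochrome?′ cases L covered) ⟩
    sum (map painted cases) * 2 ^ b             ≡⟨ sum-map-*-const painted (2 ^ b) (2 ^ n) cases painted-size ⟩
    length cases * 2 ^ n                        ≡⟨ cong (_* 2 ^ n) ∣cases∣ ⟩
    2 * length E * 2 ^ n                        ∎)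
  where
  open ≤-Reasoning
  E = edges H
  L = allSubsets n
  cases : List (Bool × Subset n)
  cases = cartesianProduct (true ∷ false ∷ []) E
  ∣cases∣ : length cases ≡ 2 * length E
  ∣cases∣ = length-cartesianProduct (true ∷ false ∷ []) E
  monochrome?′ : ∀ ce → Decidable (Monochrome (proj₁ ce) (proj₂ ce))
  monochrome?′ (c , e) = monochrome? c e
  painted : Bool × Subset n → ℕ
  painted ce = count (monochrome?′ ce) L
  covered : ∀ {V} → V ∈ₗ L → Any (λ ce → Monochrome (proj₁ ce) (proj₂ ce) V) cases
  covered {V} _ with Any.any? (λ ce → monochrome?′ ce V) cases
  ... | yes some = some
  ... | no none  = contradiction
    (Vec.lookup V , λ e e∈E (c , mono) → none (lose (∈-cartesianProduct⁺ (∈-Bool c) e∈E) mono)) ¬B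
  painted-size : ∀ {ce} → ce ∈ₗ cases → painted ce * 2 ^ b ≡ 2 ^ n
  painted-size {c , e} ce∈cases
    rewrite ≡.sym (uniform e (proj₂ (∈-cartesianProduct⁻ (true ∷ false ∷ []) E ce∈cases))) = count-monochrome n c e

IsMB⇒2^b≤2M : ∀ {b M} → IsMB b M → 2 ^ b ≤ 2 * M
IsMB⇒2^b≤2M {b} ((_ , H , uniform , ¬B , ∣H∣≡M) , _) =
  subst (λ m → 2 ^ b ≤ 2 * m) ∣H∣≡M (¬PropertyB⇒2^b≤2m H uniform ¬B)

numKs-power-≤ : ∀ {n s t} (G : Graph n) → 1 ≤ s → s ≤ t → numKs t G ^ s ≤ numKs s G ^ t
numKs-power-≤ G = root-antitone (λ j → numKs j G) step
  where
  step : ∀ j → numKs (suc j) G ^ j ≤ numKs j G ^ suc j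
  step j rewrite numKs≡cliques (suc j) G | numKs≡cliques j G = cliques-root-antitone _ (adj G) (λ _ → true) j

proposition6p5 : (s t : ℕ) → 1 ≤ s → s ≤ t → (R M : ℕ) →
    IsRKsKt s t R → IsMB (t C 2) M →
    (M ^ s ≤ R ^ t) × (2 ^ (s * (t C 2)) ≤ M ^ s * 2 ^ t)
proposition6p5 s t 1≤s s≤t R M ((_ , G , ramsey , numKs≡R) , _) isMB = M^s≤R^t , 2^sb≤M^s*2^t
  where
  open ≤-Reasoning
  b = t C 2
  M^s≤R^t : M ^ s ≤ R ^ t
  M^s≤R^t = begin
    M ^ s            ≤⟨ ^-monoˡ-≤ s (m≤numKs G isMB ramsey) ⟩
    numKs t G ^ s    ≤⟨ numKs-power-≤ G 1≤s s≤t ⟩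
    numKs s G ^ t    ≡⟨ cong (_^ t) numKs≡R ⟩
    R ^ t            ∎
  2^sb≤M^s*2^t : 2 ^ (s * b) ≤ M ^ s * 2 ^ t
  2^sb≤M^s*2^t = begin
    2 ^ (s * b)      ≡⟨ cong (2 ^_) (*-comm s b) ⟩
    2 ^ (b * s)      ≡⟨ ^-*-assoc 2 b s ⟨
    (2 ^ b) ^ s      ≤⟨ ^-monoˡ-≤ s (IsMB⇒2^b≤2M isMB) ⟩
    (2 * M) ^ s      ≡⟨ ^-distribʳ-* 2 M s ⟩
    2 ^ s * M ^ s    ≤⟨ *-monoˡ-≤ (M ^ s) (^-monoʳ-≤ 2 s≤t) ⟩
    2 ^ t * M ^ s    ≡⟨ *-comm (2 ^ t) (M ^ s) ⟩
    M ^ s * 2 ^ t    ∎
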